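{- Let $(G,L)$ be a labelled edge-coloured digraph with $L:V(G)\to[|V(G)|]$ a bijection. Then $$\Delta(\mathscr{Y}_{(G,L)}(\mathbf{x}))=\sum_F\mathscr{Y}_{(G|_{V(G)-V(F)},\,L_{V(G)-V(F)})}(\mathbf{x})\otimes\mathscr{Y}_{(F,\,L_{V(F)})}(\mathbf{x}),$$ where the sum runs over all $\{\rightarrow,\Rightarrow\}$-induced subdigraphs $F$ of $G$.
   Context: An edge-coloured digraph is a finite simple digraph whose edges are dashed ($\dashrightarrow$), solid ($\rightarrow$) or double ($\Rightarrow$). A proper vertex-colouring is $\kappa:V(G)\to\mathbb{P}$ with $\kappa(a)\ne\kappa(b)$ if $a\dashrightarrow b$, $\kappa(a)<\kappa(b)$ if $a\rightarrow b$, $\kappa(a)\le\kappa(b)$ if $a\Rightarrow b$. For a bijection $L:V(G)\to[n]$, $\mathscr{Y}_{(G,L)}(\mathbf{x})=\sum_\kappa\mathbf{x}_{\kappa(L^{ -1}(1))}\cdots\mathbf{x}_{\kappa(L^{ -1}(n))}$ over proper vertex-colourings, in noncommuting variables (empty digraph gives $1$). For $A\subseteq V(G)$, $G|_A$ is the induced subdigraph on $A$ with inherited colours, and $L_A:A\to[|A|]$ is $L_A(a)=\mathrm{std}_B(L(a))$ where $B=L(A)$ and $\mathrm{std}_B:B\to[|B|]$ is the unique order-preserving bijection. An induced subdigraph $F$ is $\{\rightarrow,\Rightarrow\}$-induced if $a\in V(F)$ and ($a\rightarrow b$ or $a\Rightarrow b$ in $G$) imply $b\in V(F)$. $\Delta$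 is the coproduct of quasisymmetric functions in noncommuting variables: evaluate $f$ on the linearly ordered alphabet $\mathbf{x}_1<\mathbf{x}_2<\cdots<\mathbf{y}_1<\mathbf{y}_2<\cdots$, impose the relations $\mathbf{x}_i\mathbf{y}_j=\mathbf{y}_j\mathbf{x}_i$, write the result as $\sum f_1(\mathbf{x})f_2(\mathbf{y})$, and set $\Delta(f)=\sum f_1(\mathbf{x})\otimes f_2(\mathbf{x})$. -}

module Defs where

open import Data.Bool using (Bool; true; false; if_then_else_; T)
open import Data.Bool.Properties using (T?)
open import Data.Nat using (ℕ; zero; suc; _+_; _*_; _<_; _≤_; _⊔_; _≟_; _<?_; _≤?_)
open import Data.Fin using (Fin; zero; suc; cast)
open import Data.Fin.Properties using (all?)
open import Data.Fin.Subset using (Subset; ∁)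
open import Data.Vec using (Vec; []; _∷_; lookup)
open import Data.List using (List; []; _∷_; length; map; _++_; foldr; concatMap)
import Data.List as List
open import Data.Nat.ListAction using (sum)
open import Data.Sum using (_⊎_; inj₁; inj₂)
open import Data.Unit using (⊤; tt)
open import Relation.Binary.PropositionalEquality using (_≡_; _≢_; sym)
open import Relation.Nullary using (Dec; yes; no; ¬_; _×-dec_; _→-dec_)
open import Relation.Nullary.Decidable using (isYes)

-- A labelled edge-coloured digraph (G,L), L : V(G) → [n] a bijection, is
-- represented by transporting G along L: the vertex with label i is the
-- element i : Fin n (labels are 0-based here, i.e. Fin n ≅ [n]).
-- E i j says which edge (if any) goes from vertex i to vertex j; a function
-- gives at most one (coloured) edge per ordered pair (simple digraph);
-- looplessness is a separate hypothesis.

data EdgeType : Set where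
  none dashed solid double : EdgeType

Digraph : ℕ → Set
Digraph n = Fin n → Fin n → EdgeType

Loopless : {n : ℕ} → Digraph n → Set
Loopless {n} E = (i : Fin n) → E i i ≡ none

-- Colours: the colour ℕ-value k stands for the positive integer k+1
-- (order isomorphism ℕ ≅ ℙ). Letter k of a word stands for x_{k+1}.

Compatible : EdgeType → ℕ → ℕ → Set
Compatible none   a b = ⊤
Compatible dashed a b = a ≢ b
Compatible solid  a b = a < b
Compatible double a b = a ≤ b

compatible? : (e : EdgeType) (a b : ℕ) → Dec (Compatible e a b)
compatible? none   a b = yes tt
compatible? dashed a b with a ≟ b
... | yes p = no (λ q → q p)
... | no ¬p = yes ¬p
compatible? solid  a b = a <? b
compatible? double a b = a ≤? b

Proper : {n : ℕ} → Digraph n → (Fin n → ℕ) → Set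
Proper {n} E κ = (i j : Fin n) → Compatible (E i j) (κ i) (κ j)

proper? : {n : ℕ} (E : Digraph n) (κ : Fin n → ℕ) → Dec (Proper E κ)
proper? E κ = all? (λ i → all? (λ j → compatible? (E i j) (κ i) (κ j)))

-- Formal power series in noncommuting variables x_1, x_2, ... with ℕ
-- coefficients, given by their coefficient function on words.
-- Tensor square: coefficient function on pairs of words (coefficient of
-- the basis element  u(x) ⊗ v(x)).

Word : Set
Word = List ℕ

Series : Set
Series = Word → ℕ

Series² : Set
Series² = Word → Word → ℕ

_⊗_ : Series → Series → Series²
(f ⊗ g) u v = f u * g v

0² : Series²
0² u v = 0

_+²_ : Series² → Series² → Series²
(f +² g) u v = f u v + g u v

_≈²_ : Series² → Series² → Set
f ≈² g = ∀ u v → f u v ≡ g u v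

-- 𝒴_(G,L)(x) = Σ_κ x_{κ(L⁻¹(1))} ⋯ x_{κ(L⁻¹(n))} over proper colourings κ.
-- Coefficient of the word w: the number of proper κ with κ(L⁻¹(j)) = w_j,
-- i.e. 1 if |w| = n and the colouring j ↦ w_j is proper, else 0.

𝒴 : (n : ℕ) → Digraph n → Series
𝒴 n E w with length w ≟ n
... | no _  = 0
... | yes p = if isYes (proper? E (λ i → List.lookup w (cast (sym p) i))) then 1 else 0

-- Evaluate f on x_1 < x_2 < ⋯ < y_1 < y_2 < ⋯ and let x's
-- commute with y's.  A word in the x/y alphabet is encoded as a list over
-- ℕ ⊎ ℕ (inj₁ k = x_{k+1}, inj₂ k = y_{k+1}).  The coefficient of u(x)v(y)
-- is the sum, over all interleavings w of u (in x) and v (in y), of the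
-- coefficient of w in f(x,y).  For quasisymmetric f this coefficient is the
-- coefficient in f of any word over ℕ order-isomorphic to w; we use the
-- order embedding inj₁ k ↦ k, inj₂ k ↦ N + k with N larger than every
-- letter of u.

shuffles : Word → Word → List (List (ℕ ⊎ ℕ))
shuffles []       v        = map inj₂ v ∷ []
shuffles (a ∷ u)  []       = map inj₁ (a ∷ u) ∷ []
shuffles (a ∷ u)  (b ∷ v)  =
  map (inj₁ a ∷_) (shuffles u (b ∷ v)) ++ map (inj₂ b ∷_) (shuffles (a ∷ u) v)

flatten : ℕ → List (ℕ ⊎ ℕ) → Word
flatten N = map f
  where
  f : ℕ ⊎ ℕ → ℕ
  f (inj₁ k) = k
  f (inj₂ k) = N + k

Δ : Series → Series²
Δ f u v = sum (map (λ w → f (flatten (suc (foldr _⊔_ 0 u)) w)) (shuffles u v))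

-- Induced labelled subdigraphs.  For A ⊆ V, (G|_A, L_A) with L_A = std ∘ L:
-- the vertex with new label k is the k-th smallest element of A
-- (enum A = std⁻¹).

size : {n : ℕ} → Subset n → ℕ
size []          = 0
size (true ∷ A)  = suc (size A)
size (false ∷ A) = size A

enum : {n : ℕ} (A : Subset n) → Fin (size A) → Fin n
enum (true ∷ A)  zero    = zero
enum (true ∷ A)  (suc k) = suc (enum A k)
enum (false ∷ A) k       = suc (enum A k)

restrict : {n : ℕ} → Digraph n → (A : Subset n) → Digraph (size A)
restrict E A k l = E (enum A k) (enum A l)

subsets : (n : ℕ) → List (Subset n)
subsets zero    = [] ∷ []
subsets (suc n) = map (true ∷_) (subsets n) ++ map (false ∷_) (subsets n)

-- F is {→,⇒}-induced: a ∈ F and (a → b or a ⇒ b) imply b ∈ F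
strong : EdgeType → Bool
strong solid  = true
strong double = true
strong _      = false

Closed : {n : ℕ} → Digraph n → Subset n → Set
Closed {n} E F = (a b : Fin n) → T (lookup F a) → T (strong (E a b)) → T (lookup F b)

closed? : {n : ℕ} (E : Digraph n) (F : Subset n) → Dec (Closed E F)
closed? E F = all? (λ a → all? (λ b → T? (lookup F a) →-dec (T? (strong (E a b)) →-dec T? (lookup F b))))

rhs : (n : ℕ) → Digraph n → Series²
rhs n E = foldr (λ F acc → term F +² acc) 0² (subsets n)
  where
  term : Subset n → Series²
  term F = if isYes (closed? E F)
           then 𝒴 (size (∁ F)) (restrict E (∁ F)) ⊗ 𝒴 (size F) (restrict E F)
           else 0²

-- The shuffles of u and v are in bijection with the subsets F ⊆ V of size |v|:
-- F is the set of positions occupied by letters of v.  Because every letter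
-- coming from v is made larger than every letter coming from u, the colouring
-- read off such a shuffle puts the vertices of F strictly above those of V − F.
-- Such a colouring is proper exactly when it is proper on V − F and on F
-- separately and no edge → or ⇒ leaves F, i.e. F is {→,⇒}-induced; so the
-- shuffle contributes 1 to Δ(𝒴) iff it contributes 1 to the F-summand.
module Submission where

open import Defs
open import Data.Bool using (Bool; true; false; if_then_else_; T; not)
open import Data.Bool.Properties using (T-≡)
open import Data.Empty using (⊥-elim)
open import Data.Fin using (Fin; zero; suc; cast; toℕ)
open import Data.Fin.Properties using (toℕ-cast)
open import Data.Fin.Subset using (Subset; ∁)
open import Data.List using (List; []; _∷_; length; map; _++_; foldr)
import Data.List as List
open import Data.List.Properties using (map-++; map-∘; map-cong; length-map)
open import Data.List.Relation.Unary.All as All using (All; []; _∷_)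
open import Data.List.Relation.Unary.All.Properties using (map⁺; ++⁺)
open import Data.Nat using (ℕ; zero; suc; _+_; _*_; _<_; _≤_; _⊔_; _≟_; z≤n; s≤s)
open import Data.Nat.ListAction using (sum)
open import Data.Nat.ListAction.Properties using (sum-++)
open import Data.Nat.Properties
  using ( +-comm; +-suc; +-identityʳ; *-identityˡ; *-zeroʳ; +-cancelʳ-≡; suc-injective
        ; ≤-trans; <-≤-trans; <-irrefl; <⇒≤; <⇒≢; <⇒≱; m≤m+n; m≤m⊔n; m≤n⊔m; n≤1+n
        ; +-cancelˡ-≡; +-cancelˡ-<; +-cancelˡ-≤; +-monoʳ-<; +-monoʳ-≤ )
open import Data.Product using (∃; _×_; _,_)
open import Data.Product.Function.NonDependent.Propositional using (_×-⇔_)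
open import Data.Sum using (_⊎_; inj₁; inj₂)
open import Data.Unit using (tt)
open import Data.Vec using ([]; _∷_; lookup)
open import Data.Vec.Properties using (lookup-map)
open import Function using (_∘_; _⇔_; mk⇔; Equivalence)
import Function.Properties.Equivalence as ⇔
open import Relation.Binary.PropositionalEquality
  using (_≡_; _≢_; _≗_; refl; sym; trans; cong; cong₂; subst; subst₂; module ≡-Reasoning)
open import Relation.Nullary using (Dec; yes; no; ¬_; _×-dec_)
open import Relation.Nullary.Decidable using (isYes)

open Equivalence using (to; from)

𝟙 : {P : Set} → Dec P → ℕ
𝟙 p? = if isYes p? then 1 else 0

module _ {P Q : Set} where

  𝟙-⇔ : (p? : Dec P) (q? : Dec Q) → P ⇔ Q → 𝟙 p? ≡ 𝟙 q?
  𝟙-⇔ (yes _) (yes _) _   = refl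
  𝟙-⇔ (no _)  (no _)  _   = refl
  𝟙-⇔ (yes p) (no ¬q) P⇔Q = ⊥-elim (¬q (to P⇔Q p))
  𝟙-⇔ (no ¬p) (yes q) P⇔Q = ⊥-elim (¬p (from P⇔Q q))

  𝟙-× : (p? : Dec P) (q? : Dec Q) → 𝟙 p? * 𝟙 q? ≡ 𝟙 (p? ×-dec q?)
  𝟙-× (yes _) (yes _) = refl
  𝟙-× (yes _) (no _)  = refl
  𝟙-× (no _)  _       = refl

𝟙-no : {P : Set} (p? : Dec P) → ¬ P → 𝟙 p? ≡ 0
𝟙-no (yes p) ¬p = ⊥-elim (¬p p)
𝟙-no (no _)  _  = refl

𝟙-suc≟suc : (m n : ℕ) → 𝟙 (suc m ≟ suc n) ≡ 𝟙 (m ≟ n)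
𝟙-suc≟suc m n = 𝟙-⇔ (suc m ≟ suc n) (m ≟ n) (mk⇔ suc-injective (cong suc))

module _ {A B : Set} where

  sum-map-++-map : (g : B → ℕ) (f f′ : A → B) (xs ys : List A) →
    sum (map g (map f xs ++ map f′ ys)) ≡ sum (map (g ∘ f) xs) + sum (map (g ∘ f′) ys)
  sum-map-++-map g f f′ xs ys = begin
    sum (map g (map f xs ++ map f′ ys))             ≡⟨ cong sum (map-++ g (map f xs) (map f′ ys)) ⟩
    sum (map g (map f xs) ++ map g (map f′ ys))     ≡⟨ sum-++ (map g (map f xs)) (map g (map f′ ys)) ⟩
    sum (map g (map f xs)) + sum (map g (map f′ ys)) ≡⟨ sym (cong₂ (λ s t → sum s + sum t) (map-∘ xs) (map-∘ ys)) ⟩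
    sum (map (g ∘ f) xs) + sum (map (g ∘ f′) ys)     ∎
    where open ≡-Reasoning

sum-map-zero : {A : Set} {f : A → ℕ} {xs : List A} → All (λ x → f x ≡ 0) xs → sum (map f xs) ≡ 0
sum-map-zero []       = refl
sum-map-zero (p ∷ ps) = cong₂ _+_ p (sum-map-zero ps)

foldr-+²-sum : {A : Set} (t : A → Series²) (xs : List A) (u v : Word) →
  foldr (λ x acc → t x +² acc) 0² xs u v ≡ sum (map (λ x → t x u v) xs)
foldr-+²-sum t []       u v = refl
foldr-+²-sum t (x ∷ xs) u v = cong (t x u v +_) (foldr-+²-sum t xs u v)

if-0²-apply : (b : Bool) (f : Series²) (u v : Word) →
  (if b then f else 0²) u v ≡ (if b then 1 else 0) * f u v
if-0²-apply true  f u v = sym (*-identityˡ (f u v))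
if-0²-apply false f u v = refl

-- Total lookup: out-of-range positions read 0, matching the junk head of [].
lk : Word → ℕ → ℕ
lk []      _       = 0
lk (a ∷ w) zero    = a
lk (a ∷ w) (suc j) = lk w j

hd : Word → ℕ
hd []      = 0
hd (a ∷ _) = a

tl : Word → Word
tl []      = []
tl (_ ∷ w) = w

colouring : {n : ℕ} → Word → Fin n → ℕ
colouring w i = lk w (toℕ i)

lk<suc-max : (w : Word) (j : ℕ) → lk w j < suc (foldr _⊔_ 0 w)
lk<suc-max []      j       = s≤s z≤n
lk<suc-max (a ∷ w) zero    = s≤s (m≤m⊔n a _)
lk<suc-max (a ∷ w) (suc j) = ≤-trans (lk<suc-max w j) (s≤s (m≤n⊔m a _))

lookup≡lk : (w : Word) (j : Fin (length w)) → List.lookup w j ≡ lk w (toℕ j)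
lookup≡lk (a ∷ w) zero    = refl
lookup≡lk (a ∷ w) (suc j) = lookup≡lk w j

size-∁+size : {n : ℕ} (F : Subset n) → size (∁ F) + size F ≡ n
size-∁+size []          = refl
size-∁+size (true ∷ F)  = trans (+-suc (size (∁ F)) (size F)) (cong suc (size-∁+size F))
size-∁+size (false ∷ F) = cong suc (size-∁+size F)

size≤ : {n : ℕ} (F : Subset n) → size F ≤ n
size≤ []          = z≤n
size≤ (true ∷ F)  = s≤s (size≤ F)
size≤ (false ∷ F) = ≤-trans (size≤ F) (n≤1+n _)

enum-onto : {n : ℕ} (A : Subset n) (i : Fin n) → lookup A i ≡ true → ∃ λ k → enum A k ≡ i
enum-onto (true ∷ A)  zero    _ = zero , refl
enum-onto (true ∷ A)  (suc i) e with enum-onto A i e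
... | k , refl = suc k , refl
enum-onto (false ∷ A) (suc i) e with enum-onto A i e
... | k , refl = k , refl

enum-∁-onto : {n : ℕ} (A : Subset n) (i : Fin n) → lookup A i ≡ false → ∃ λ k → enum (∁ A) k ≡ i
enum-∁-onto A i e = enum-onto (∁ A) i (trans (lookup-map i _ A) (cong not e))

Compatible-strong⇒≤ : (e : EdgeType) {x y : ℕ} → T (strong e) → Compatible e x y → x ≤ y
Compatible-strong⇒≤ solid  _ x<y = <⇒≤ x<y
Compatible-strong⇒≤ double _ x≤y = x≤y

<⇒Compatible : (e : EdgeType) {x y : ℕ} → x < y → Compatible e x y
<⇒Compatible none   _   = tt
<⇒Compatible dashed x<y = <⇒≢ x<y
<⇒Compatible solid  x<y = x<y
<⇒Compatible double x<y = <⇒≤ x<y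

>⇒Compatible : (e : EdgeType) {x y : ℕ} → y < x → ¬ T (strong e) → Compatible e x y
>⇒Compatible none   _   _  = tt
>⇒Compatible dashed y<x _  = λ x≡y → <⇒≢ y<x (sym x≡y)
>⇒Compatible solid  _   ¬s = ⊥-elim (¬s tt)
>⇒Compatible double _   ¬s = ⊥-elim (¬s tt)

Compatible-+ˡ : (e : EdgeType) (m x y : ℕ) → Compatible e (m + x) (m + y) ⇔ Compatible e x y
Compatible-+ˡ none   m x y = mk⇔ (λ _ → tt) (λ _ → tt)
Compatible-+ˡ dashed m x y = mk⇔ (λ m+x≢m+y → m+x≢m+y ∘ cong (m +_)) (λ x≢y → x≢y ∘ +-cancelˡ-≡ m x y)
Compatible-+ˡ solid  m x y = mk⇔ (+-cancelˡ-< m x y) (+-monoʳ-< m)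
Compatible-+ˡ double m x y = mk⇔ (+-cancelˡ-≤ m x y) (+-monoʳ-≤ m)

module _ {n : ℕ} (E : Digraph n) where

  Proper-cong : {κ κ′ : Fin n → ℕ} → κ ≗ κ′ → Proper E κ → Proper E κ′
  Proper-cong κ≗κ′ P i j = subst₂ (Compatible (E i j)) (κ≗κ′ i) (κ≗κ′ j) (P i j)

  Proper-cong-⇔ : {κ κ′ : Fin n → ℕ} → κ ≗ κ′ → Proper E κ ⇔ Proper E κ′
  Proper-cong-⇔ κ≗κ′ = mk⇔ (Proper-cong κ≗κ′) (Proper-cong (sym ∘ κ≗κ′))

  Proper-+ˡ : (m : ℕ) (κ : Fin n → ℕ) → Proper E (λ i → m + κ i) ⇔ Proper E κ
  Proper-+ˡ m κ = mk⇔ (λ P i j → to (Compatible-+ˡ (E i j) m _ _) (P i j))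
                      (λ P i j → from (Compatible-+ˡ (E i j) m _ _) (P i j))

  Proper-restrict : (A : Subset n) {κ : Fin n → ℕ} → Proper E κ → Proper (restrict E A) (κ ∘ enum A)
  Proper-restrict A P k l = P (enum A k) (enum A l)

module Separated {n : ℕ} (E : Digraph n) (F : Subset n) (κ : Fin n → ℕ)
  (separated : ∀ i j → lookup F i ≡ false → lookup F j ≡ true → κ i < κ j) where

  proper⇒closed : Proper E κ → Closed E F
  proper⇒closed P a b a∈F a⇒b with lookup F b in b∉F
  ... | true  = tt
  ... | false = <⇒≱ (separated b a b∉F (to T-≡ a∈F)) (Compatible-strong⇒≤ (E a b) a⇒b (P a b))

  closed⇒proper : Closed E F → Proper (restrict E (∁ F)) (κ ∘ enum (∁ F)) →
                  Proper (restrict E F) (κ ∘ enum F) → Proper E κ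
  closed⇒proper closed P∁ P∈ i j with lookup F i in i∈? | lookup F j in j∈?
  ... | false | false with enum-∁-onto F i i∈? | enum-∁-onto F j j∈?
  ...   | k , refl | l , refl = P∁ k l
  closed⇒proper closed P∁ P∈ i j | true | true with enum-onto F i i∈? | enum-onto F j j∈?
  ...   | k , refl | l , refl = P∈ k l
  closed⇒proper closed P∁ P∈ i j | false | true = <⇒Compatible (E i j) (separated i j i∈? j∈?)
  closed⇒proper closed P∁ P∈ i j | true | false =
    >⇒Compatible (E i j) (separated j i j∈? i∈?)
      (λ i⇒j → subst T j∈? (closed i j (from T-≡ i∈?) i⇒j))

  proper⇔closed×parts : Proper E κ ⇔
    (Closed E F × Proper (restrict E (∁ F)) (κ ∘ enum (∁ F)) × Proper (restrict E F) (κ ∘ enum F))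
  proper⇔closed×parts =
    mk⇔ (λ P → proper⇒closed P , Proper-restrict E (∁ F) P , Proper-restrict E F P)
        (λ (closed , P∁ , P∈) → closed⇒proper closed P∁ P∈)

interleave : {n : ℕ} → Subset n → Word → Word → List (ℕ ⊎ ℕ)
interleave []          u v = []
interleave (true ∷ F)  u v = inj₂ (hd v) ∷ interleave F u (tl v)
interleave (false ∷ F) u v = inj₁ (hd u) ∷ interleave F (tl u) v

length-interleave : {n : ℕ} (F : Subset n) (u v : Word) → length (interleave F u v) ≡ n
length-interleave []          u v = refl
length-interleave (true ∷ F)  u v = cong suc (length-interleave F u (tl v))
length-interleave (false ∷ F) u v = cong suc (length-interleave F (tl u) v)

module _ (M : ℕ) where

  colouring-interleave-∁ : {n : ℕ} (F : Subset n) (u v : Word) →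
    colouring (flatten M (interleave F u v)) ∘ enum (∁ F) ≗ colouring u
  colouring-interleave-∁ (true ∷ F)  u       v k       = colouring-interleave-∁ F u (tl v) k
  colouring-interleave-∁ (false ∷ F) []      v zero    = refl
  colouring-interleave-∁ (false ∷ F) (a ∷ u) v zero    = refl
  colouring-interleave-∁ (false ∷ F) []      v (suc k) = colouring-interleave-∁ F [] v k
  colouring-interleave-∁ (false ∷ F) (a ∷ u) v (suc k) = colouring-interleave-∁ F u v k

  colouring-interleave-∈ : {n : ℕ} (F : Subset n) (u v : Word) →
    colouring (flatten M (interleave F u v)) ∘ enum F ≗ (M +_) ∘ colouring v
  colouring-interleave-∈ (true ∷ F)  u []      zero    = refl
  colouring-interleave-∈ (true ∷ F)  u (b ∷ v) zero    = refl
  colouring-interleave-∈ (true ∷ F)  u []      (suc k) = colouring-interleave-∈ F u [] k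
  colouring-interleave-∈ (true ∷ F)  u (b ∷ v) (suc k) = colouring-interleave-∈ F u v k
  colouring-interleave-∈ (false ∷ F) u v       k       = colouring-interleave-∈ F (tl u) v k

  module _ {n : ℕ} (E : Digraph n) (F : Subset n) (u v : Word) (u<M : ∀ j → lk u j < M) where

    private
      κ : Fin n → ℕ
      κ = colouring (flatten M (interleave F u v))

    interleave-separated : ∀ i j → lookup F i ≡ false → lookup F j ≡ true → κ i < κ j
    interleave-separated i j i∉F j∈F with enum-∁-onto F i i∉F | enum-onto F j j∈F
    ... | k , refl | l , refl =
      subst₂ _<_ (sym (colouring-interleave-∁ F u v k)) (sym (colouring-interleave-∈ F u v l))
        (<-≤-trans (u<M (toℕ k)) (m≤m+n M _))

    proper-interleave⇔ : Proper E κ ⇔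
      (Closed E F × Proper (restrict E (∁ F)) (colouring u) × Proper (restrict E F) (colouring v))
    proper-interleave⇔ =
      ⇔.trans (Separated.proper⇔closed×parts E F κ interleave-separated)
        (⇔.refl ×-⇔ (Proper-cong-⇔ (restrict E (∁ F)) (colouring-interleave-∁ F u v)
                    ×-⇔ ⇔.trans (Proper-cong-⇔ (restrict E F) (colouring-interleave-∈ F u v))
                                (Proper-+ˡ (restrict E F) M (colouring v))))

𝒴-length≡ : (n : ℕ) (E : Digraph n) (w : Word) → length w ≡ n → 𝒴 n E w ≡ 𝟙 (proper? E (colouring w))
𝒴-length≡ n E w ∣w∣≡n with length w ≟ n
... | no ∣w∣≢n = ⊥-elim (∣w∣≢n ∣w∣≡n)
... | yes ∣w∣≡n′ = 𝟙-⇔ _ _ (Proper-cong-⇔ E lookup≗colouring)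
  where
  lookup≗colouring : (λ i → List.lookup w (cast (sym ∣w∣≡n′) i)) ≗ colouring w
  lookup≗colouring i = trans (lookup≡lk w (cast (sym ∣w∣≡n′) i)) (cong (lk w) (toℕ-cast (sym ∣w∣≡n′) i))

𝒴-length≢ : (n : ℕ) (E : Digraph n) (w : Word) → length w ≢ n → 𝒴 n E w ≡ 0
𝒴-length≢ n E w ∣w∣≢n with length w ≟ n
... | no _       = refl
... | yes ∣w∣≡n = ⊥-elim (∣w∣≢n ∣w∣≡n)

shuffles-length : (u v : Word) → All (λ w → length w ≡ length u + length v) (shuffles u v)
shuffles-length []      v       = length-map inj₂ v ∷ []
shuffles-length (a ∷ u) []      = trans (length-map inj₁ (a ∷ u)) (sym (+-identityʳ _)) ∷ []
shuffles-length (a ∷ u) (b ∷ v) =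
  ++⁺ (map⁺ (All.map (cong suc) (shuffles-length u (b ∷ v))))
      (map⁺ (All.map (λ e → trans (cong suc e) (sym (+-suc (suc (length u)) (length v))))
                     (shuffles-length (a ∷ u) v)))

shuffles-[] : (u : Word) → shuffles u [] ≡ map inj₁ u ∷ []
shuffles-[] []      = refl
shuffles-[] (a ∷ u) = refl

shuffle-weight : {m : ℕ} (u v : Word) (g : List (ℕ ⊎ ℕ) → ℕ) → Subset m → ℕ
shuffle-weight u v g F = 𝟙 (size F ≟ length v) * g (interleave F u v)

shuffle-weight-true : {m : ℕ} (u : Word) (b : ℕ) (v : Word) (g : List (ℕ ⊎ ℕ) → ℕ) (F : Subset m) →
  shuffle-weight u (b ∷ v) g (true ∷ F) ≡ shuffle-weight u v (g ∘ (inj₂ b ∷_)) F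
shuffle-weight-true u b v g F =
  cong (_* g (inj₂ b ∷ interleave F u v)) (𝟙-suc≟suc (size F) (length v))

sum-subsets-suc : (m : ℕ) (h : Subset (suc m) → ℕ) →
  sum (map h (subsets (suc m))) ≡ sum (map (h ∘ (true ∷_)) (subsets m)) + sum (map (h ∘ (false ∷_)) (subsets m))
sum-subsets-suc m h = sum-map-++-map h (true ∷_) (false ∷_) (subsets m) (subsets m)

sum-shuffles : (m : ℕ) (u v : Word) (g : List (ℕ ⊎ ℕ) → ℕ) → length u + length v ≡ m →
  sum (map g (shuffles u v)) ≡ sum (map (shuffle-weight u v g) (subsets m))
sum-shuffles zero    []      []      g _  = cong (_+ 0) (sym (+-identityʳ (g [])))
sum-shuffles (suc m) []      (b ∷ v) g eq = begin
  sum (map (g ∘ (inj₂ b ∷_)) (shuffles [] v))                  ≡⟨ sum-shuffles m [] v (g ∘ (inj₂ b ∷_)) ∣v∣≡m ⟩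
  sum (map (shuffle-weight [] v (g ∘ (inj₂ b ∷_))) (subsets m)) ≡⟨ sum-true-part ⟩
  true-part                                                     ≡⟨ sym (+-identityʳ true-part) ⟩
  true-part + 0                                                 ≡⟨ cong (true-part +_) (sym false-part≡0) ⟩
  true-part + false-part                                        ≡⟨ sym (sum-subsets-suc m w) ⟩
  sum (map w (subsets (suc m)))                                 ∎
  where
  open ≡-Reasoning
  ∣v∣≡m : length v ≡ m
  ∣v∣≡m = suc-injective eq
  w : Subset (suc m) → ℕ
  w = shuffle-weight [] (b ∷ v) g
  true-part false-part : ℕ
  true-part  = sum (map (w ∘ (true ∷_)) (subsets m))
  false-part = sum (map (w ∘ (false ∷_)) (subsets m))
  sum-true-part : sum (map (shuffle-weight [] v (g ∘ (inj₂ b ∷_))) (subsets m)) ≡ true-part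
  sum-true-part = sym (cong sum (map-cong (shuffle-weight-true [] b v g) (subsets m)))
  too-big : ∀ F → w (false ∷ F) ≡ 0
  too-big F = cong (_* g (interleave (false ∷ F) [] (b ∷ v))) (𝟙-no (size F ≟ suc (length v)) λ ∣F∣≡1+∣v∣ →
    <-irrefl refl (subst (_≤ length v) ∣F∣≡1+∣v∣ (subst (size F ≤_) (sym ∣v∣≡m) (size≤ F))))
  false-part≡0 : false-part ≡ 0
  false-part≡0 = sum-map-zero (All.universal too-big (subsets m))
sum-shuffles (suc m) (a ∷ u) []      g eq = begin
  sum (map g (shuffles (a ∷ u) []))                ≡⟨ cong (sum ∘ map (g ∘ (inj₁ a ∷_))) (sym (shuffles-[] u)) ⟩
  sum (map (g ∘ (inj₁ a ∷_)) (shuffles u []))      ≡⟨ sum-shuffles m u [] (g ∘ (inj₁ a ∷_)) (suc-injective eq) ⟩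
  false-part                                       ≡⟨ cong (_+ false-part) (sym true-part≡0) ⟩
  true-part + false-part                           ≡⟨ sym (sum-subsets-suc m w) ⟩
  sum (map w (subsets (suc m)))                    ∎
  where
  open ≡-Reasoning
  w : Subset (suc m) → ℕ
  w = shuffle-weight (a ∷ u) [] g
  true-part false-part : ℕ
  true-part  = sum (map (w ∘ (true ∷_)) (subsets m))
  false-part = sum (map (w ∘ (false ∷_)) (subsets m))
  true-part≡0 : true-part ≡ 0
  true-part≡0 = sum-map-zero (All.universal (λ _ → refl) (subsets m))
sum-shuffles (suc m) (a ∷ u) (b ∷ v) g eq = begin
  sum (map g (map (inj₁ a ∷_) (shuffles u (b ∷ v)) ++ map (inj₂ b ∷_) (shuffles (a ∷ u) v)))
    ≡⟨ sum-map-++-map g (inj₁ a ∷_) (inj₂ b ∷_) (shuffles u (b ∷ v)) (shuffles (a ∷ u) v) ⟩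
  sum (map (g ∘ (inj₁ a ∷_)) (shuffles u (b ∷ v))) + sum (map (g ∘ (inj₂ b ∷_)) (shuffles (a ∷ u) v))
    ≡⟨ cong₂ _+_ (sum-shuffles m u (b ∷ v) (g ∘ (inj₁ a ∷_)) (suc-injective eq))
                 (sum-shuffles m (a ∷ u) v (g ∘ (inj₂ b ∷_))
                   (suc-injective (trans (sym (+-suc (suc (length u)) (length v))) eq))) ⟩
  false-part + sum (map (shuffle-weight (a ∷ u) v (g ∘ (inj₂ b ∷_))) (subsets m))
    ≡⟨ cong (false-part +_) sum-true-part ⟩
  false-part + true-part
    ≡⟨ +-comm false-part true-part ⟩
  true-part + false-part
    ≡⟨ sym (sum-subsets-suc m w) ⟩
  sum (map w (subsets (suc m)))
    ∎
  where
  open ≡-Reasoning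
  w : Subset (suc m) → ℕ
  w = shuffle-weight (a ∷ u) (b ∷ v) g
  true-part false-part : ℕ
  true-part  = sum (map (w ∘ (true ∷_)) (subsets m))
  false-part = sum (map (w ∘ (false ∷_)) (subsets m))
  sum-true-part : sum (map (shuffle-weight (a ∷ u) v (g ∘ (inj₂ b ∷_))) (subsets m)) ≡ true-part
  sum-true-part = sym (cong sum (map-cong (shuffle-weight-true (a ∷ u) b v g) (subsets m)))

rhs-as-sum : (n : ℕ) (E : Digraph n) (u v : Word) → rhs n E u v ≡
  sum (map (λ F → 𝟙 (closed? E F) * (𝒴 (size (∁ F)) (restrict E (∁ F)) u * 𝒴 (size F) (restrict E F) v))
           (subsets n))
rhs-as-sum n E u v =
  trans (foldr-+²-sum summand (subsets n) u v)
        (cong sum (map-cong (λ F → if-0²-apply (isYes (closed? E F)) (part F) u v) (subsets n)))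
  where
  part : Subset n → Series²
  part F = 𝒴 (size (∁ F)) (restrict E (∁ F)) ⊗ 𝒴 (size F) (restrict E F)
  summand : Subset n → Series²
  summand F = if isYes (closed? E F) then part F else 0²

module Coproduct {n : ℕ} (E : Digraph n) (u v : Word) where

  M : ℕ
  M = suc (foldr _⊔_ 0 u)

  Y∁ : Subset n → ℕ
  Y∁ F = 𝒴 (size (∁ F)) (restrict E (∁ F)) u

  Y∈ : Subset n → ℕ
  Y∈ F = 𝒴 (size F) (restrict E F) v

  𝒴-shuffle : List (ℕ ⊎ ℕ) → ℕ
  𝒴-shuffle w = 𝒴 n E (flatten M w)

  summand-vanishes : ∀ F → Y∁ F ≡ 0 ⊎ Y∈ F ≡ 0 → 𝟙 (closed? E F) * (Y∁ F * Y∈ F) ≡ 0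
  summand-vanishes F (inj₁ Y∁≡0) =
    trans (cong (λ y → 𝟙 (closed? E F) * (y * Y∈ F)) Y∁≡0) (*-zeroʳ (𝟙 (closed? E F)))
  summand-vanishes F (inj₂ Y∈≡0) =
    trans (cong (λ y → 𝟙 (closed? E F) * (Y∁ F * y)) Y∈≡0)
          (trans (cong (𝟙 (closed? E F) *_) (*-zeroʳ (Y∁ F))) (*-zeroʳ (𝟙 (closed? E F))))

  summand-sized : length u + length v ≡ n → ∀ F →
    shuffle-weight u v 𝒴-shuffle F ≡ 𝟙 (closed? E F) * (Y∁ F * Y∈ F)
  summand-sized ∣u∣+∣v∣≡n F with size F ≟ length v
  ... | no ∣F∣≢∣v∣ = sym (summand-vanishes F (inj₂ (𝒴-length≢ _ _ v (∣F∣≢∣v∣ ∘ sym))))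
  ... | yes ∣F∣≡∣v∣ = begin
    1 * 𝒴 n E w                              ≡⟨ *-identityˡ (𝒴 n E w) ⟩
    𝒴 n E w                                  ≡⟨ 𝒴-length≡ n E w ∣w∣≡n ⟩
    𝟙 (proper? E (colouring w))              ≡⟨ 𝟙-⇔ _ _ (proper-interleave⇔ M E F u v (lk<suc-max u)) ⟩
    𝟙 (closed? E F ×-dec (P∁? ×-dec P∈?))    ≡⟨ sym (trans (cong (𝟙 (closed? E F) *_) (𝟙-× P∁? P∈?))
                                                          (𝟙-× (closed? E F) (P∁? ×-dec P∈?))) ⟩
    𝟙 (closed? E F) * (𝟙 P∁? * 𝟙 P∈?)        ≡⟨ sym (cong (𝟙 (closed? E F) *_)
                                                     (cong₂ _*_ (𝒴-length≡ _ _ u ∣u∣≡∣∁F∣) (𝒴-length≡ _ _ v (sym ∣F∣≡∣v∣)))) ⟩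
    𝟙 (closed? E F) * (Y∁ F * Y∈ F)          ∎
    where
    open ≡-Reasoning
    w : Word
    w = flatten M (interleave F u v)
    ∣w∣≡n : length w ≡ n
    ∣w∣≡n = trans (length-map _ (interleave F u v)) (length-interleave F u v)
    P∁? : Dec (Proper (restrict E (∁ F)) (colouring u))
    P∁? = proper? (restrict E (∁ F)) (colouring u)
    P∈? : Dec (Proper (restrict E F) (colouring v))
    P∈? = proper? (restrict E F) (colouring v)
    ∣u∣≡∣∁F∣ : length u ≡ size (∁ F)
    ∣u∣≡∣∁F∣ = +-cancelʳ-≡ (size F) (length u) (size (∁ F))
                 (trans (cong (length u +_) ∣F∣≡∣v∣) (trans ∣u∣+∣v∣≡n (sym (size-∁+size F))))

  summand-unsized : length u + length v ≢ n → ∀ F → 𝟙 (closed? E F) * (Y∁ F * Y∈ F) ≡ 0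
  summand-unsized ∣u∣+∣v∣≢n F = by-sizes (length u ≟ size (∁ F)) (length v ≟ size F)
    where
    by-sizes : Dec (length u ≡ size (∁ F)) → Dec (length v ≡ size F) →
               𝟙 (closed? E F) * (Y∁ F * Y∈ F) ≡ 0
    by-sizes (no ∣u∣≢∣∁F∣) _            = summand-vanishes F (inj₁ (𝒴-length≢ _ _ u ∣u∣≢∣∁F∣))
    by-sizes (yes _)       (no ∣v∣≢∣F∣) = summand-vanishes F (inj₂ (𝒴-length≢ _ _ v ∣v∣≢∣F∣))
    by-sizes (yes ∣u∣≡∣∁F∣) (yes ∣v∣≡∣F∣) =
      ⊥-elim (∣u∣+∣v∣≢n (trans (cong₂ _+_ ∣u∣≡∣∁F∣ ∣v∣≡∣F∣) (size-∁+size F)))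

  shuffles-unsized : length u + length v ≢ n → All (λ w → 𝒴-shuffle w ≡ 0) (shuffles u v)
  shuffles-unsized ∣u∣+∣v∣≢n =
    All.map (λ {w} ∣w∣≡∣u∣+∣v∣ → 𝒴-length≢ n E (flatten M w) λ ∣flat∣≡n →
               ∣u∣+∣v∣≢n (trans (sym ∣w∣≡∣u∣+∣v∣) (trans (sym (length-map _ w)) ∣flat∣≡n)))
            (shuffles-length u v)

-- The identity holds for digraphs with loops too.
mainTheorem16 : (n : ℕ) (E : Digraph n) → Loopless E →
    Δ (𝒴 n E) ≈² rhs n E
mainTheorem16 n E _ u v with length u + length v ≟ n
... | yes sized = begin
  Δ (𝒴 n E) u v
    ≡⟨ sum-shuffles n u v 𝒴-shuffle sized ⟩
  sum (map (shuffle-weight u v 𝒴-shuffle) (subsets n))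
    ≡⟨ cong sum (map-cong (summand-sized sized) (subsets n)) ⟩
  sum (map (λ F → 𝟙 (closed? E F) * (Y∁ F * Y∈ F)) (subsets n))
    ≡⟨ sym (rhs-as-sum n E u v) ⟩
  rhs n E u v ∎
  where open ≡-Reasoning
        open Coproduct E u v
... | no unsized =
  trans (sum-map-zero (shuffles-unsized unsized))
        (sym (trans (rhs-as-sum n E u v) (sum-map-zero (All.universal (summand-unsized unsized) (subsets n)))))
  where open Coproduct E u v
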